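{- Consider tilings with half-squares, fences and combs. For $m_1,m_2\in\{1,2,3\}$ let $\mu_l^{[m_1m_2]}$ denote the number of metatiles of length $l$ whose last cell has its left slot filled by a tooth of a $(\frac12,\frac12;m_1)$-comb and its right slot filled by a tooth of a $(\frac12,\frac12;m_2)$-comb (with $\mu_l^{[m_1m_2]}=0$ for $l\le 0$). Then for all integers $l$, \begin{align*} \mu_l^{[12]}&=\mu_{l-1}^{[12]}+\mu_{l-2}^{[12]}+\mu_{l-3}^{[12]}+\delta_{l,2}+\delta_{l,4}, \quad \mu_{l}^{[12]}=0 \text{ for } l<2,\\ \mu_l^{[13]}&=\mu_{l-1}^{[13]}+\mu_{l-2}^{[13]}+\mu_{l-3}^{[13]}+2\delta_{l,3}, \quad \mu_{l}^{[13]}=0 \text{ for } l<3,\\ \mu_l^{[23]}&=\mu_{l-1}^{[23]}+\mu_{l-2}^{[23]}+\mu_{l-3}^{[23]}+\delta_{l,3}+\delta_{l,5}, \quad \mu_{l}^{[23]}=0 \text{ for } l<3, \end{align*} where $\delta_{i,j}$ is $1$ if $i=j$ and $0$ otherwise.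
   Context: An $n$-board is a linear array of $n$ unit square cells; each cell is split into a left half and a right half, called slots. For a positive integer $m$, a $(\frac12,\frac12;m)$-comb is a tile consisting of $m$ teeth of size $\frac12\times1$ in a row, consecutive teeth separated by gaps of size $\frac12\times1$; placed on a board it covers $m$ slots of the same kind (all left or all right) in $m$ consecutive cells, and its gaps may be filled by other tiles. Half-squares ($h$), fences ($f$), and combs ($c$) are the $(\frac12,\frac12;m)$-combs with $m=1,2,3$. A tiling covers every slot by exactly one tooth. A metatile of length $l$ is a tiling of an $l$-board by $h$, $f$, $c$ such that for every $1\le j\le l-1$ some tile has teeth both in cells $1,\dots,j$ and in cells $j+1,\dots,l$. -}

module Defs where

open import Data.Nat using (ℕ; zero; suc; _+_; _∸_; _≤_; _<_; _≤?_; _<?_)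
open import Data.Nat.Properties using () renaming (_≟_ to _≟ℕ_)
open import Data.Fin using (Fin; toℕ; fromℕ)
open import Data.Fin.Properties using (all?; any?)
open import Data.Vec using (Vec; []; _∷_; lookup)
open import Data.List using (List; []; _∷_; _++_; map; concatMap; filter; length)
open import Data.Product using (Σ; ∃; _×_; _,_; proj₁; proj₂)
open import Data.Sum using (_⊎_)
open import Data.Empty using (⊥)
open import Data.Integer using (ℤ; +_; -[1+_])
open import Relation.Nullary using (Dec; yes; no; does)
open import Relation.Nullary.Decidable using (_×-dec_; _⊎-dec_; _→-dec_)
open import Relation.Binary.PropositionalEquality using (_≡_)

-- In a tiling by h, f, c every slot is covered by exactly
-- one tooth; we record, for each slot, the size m ∈ {1,2,3} of the comb
-- whose tooth covers it and the index k (0 ≤ k < m) of that tooth within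
-- the comb (teeth counted from the left).

data Label : Set where
  h₀ f₀ f₁ c₀ c₁ c₂ : Label

allLabels : List Label
allLabels = h₀ ∷ f₀ ∷ f₁ ∷ c₀ ∷ c₁ ∷ c₂ ∷ []

size : Label → ℕ
size h₀ = 1
size f₀ = 2
size f₁ = 2
size c₀ = 3
size c₁ = 3
size c₂ = 3

tooth : Label → ℕ
tooth h₀ = 0
tooth f₀ = 0
tooth f₁ = 1
tooth c₀ = 0
tooth c₁ = 1
tooth c₂ = 2

-- A labelled l-board: cells 0,…,l-1 (cell i here is cell i+1 of the
-- paper), each with a left and a right slot.

data Side : Set where
  left right : Side

Board : ℕ → Set
Board l = Vec Label l × Vec Label l

slot : ∀ {l} → Board l → Side → Fin l → Label
slot (L , R) left  i = lookup L i
slot (L , R) right i = lookup R i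

-- A comb with m teeth of one kind (left/right) whose first tooth is in
-- cell s covers the slots of that kind in cells s, s+1, …, s+m-1.
-- The slot (i , σ) carrying label λ belongs to the comb with m = size lab
-- starting at cell s = i - tooth lab.  The labelling is a tiling iff for
-- every slot this comb lies within the board and every slot it covers
-- carries the label of that comb with the right tooth index.
-- (Valid labellings are in bijection with tilings.)
Consistent : ∀ {l} → Board l → Side → Fin l → Set
Consistent {l} b σ i =
  tooth lab ≤ toℕ i
  × (toℕ i ∸ tooth lab) + size lab ≤ l
  × (∀ (j : Fin l) → toℕ i ∸ tooth lab ≤ toℕ j → toℕ j < (toℕ i ∸ tooth lab) + size lab →
       (size (slot b σ j) ≡ size lab) × (tooth (slot b σ j) + toℕ i ≡ toℕ j + tooth lab))
  where lab = slot b σ i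

IsTiling : ∀ {l} → Board l → Set
IsTiling {l} b = ∀ (σ : Side) (i : Fin l) → Consistent b σ i

-- The tile covering slot (i , σ) has teeth both in cells < j and in
-- cells ≥ j (0-based), i.e. it starts before cell j and its last tooth,
-- in cell i - tooth + size - 1, lies in a cell ≥ j.
Crosses : ∀ {l} → Board l → (j : ℕ) → Side → Fin l → Set
Crosses b j σ i = (toℕ i < j) × (j < (toℕ i ∸ tooth (slot b σ i)) + size (slot b σ i))

-- Metatile: a tiling such that for every cut between cells (paper's
-- 1 ≤ j ≤ l-1) some tile has teeth on both sides of the cut.
IsMetatile : ∀ {l} → Board l → Set
IsMetatile {l} b =
  IsTiling b ×
  (∀ (j : Fin l) → 1 ≤ toℕ j → ∃ λ (i : Fin l) → Crosses b (toℕ j) left i ⊎ Crosses b (toℕ j) right i)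

EndsWith : ℕ → ℕ → ∀ {l} → Board l → Set
EndsWith m₁ m₂ {zero}  b = ⊥
EndsWith m₁ m₂ {suc n} b = (size (slot b left (fromℕ n)) ≡ m₁) × (size (slot b right (fromℕ n)) ≡ m₂)

consistent? : ∀ {l} (b : Board l) σ i → Dec (Consistent b σ i)
consistent? {l} b σ i =
  (tooth lab ≤? toℕ i) ×-dec ((toℕ i ∸ tooth lab) + size lab ≤? l) ×-dec
  all? (λ j → (toℕ i ∸ tooth lab ≤? toℕ j) →-dec (toℕ j <? (toℕ i ∸ tooth lab) + size lab) →-dec
              ((size (slot b σ j) ≟ℕ size lab) ×-dec (tooth (slot b σ j) + toℕ i ≟ℕ toℕ j + tooth lab)))
  where lab = slot b σ i

side? : ∀ {p} {P : Side → Set p} → (∀ σ → Dec (P σ)) → Dec (∀ σ → P σ)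
side? {P = P} d with d left | d right
... | yes a | yes c = yes λ { left → a ; right → c }
... | no ¬a | _     = no λ f → ¬a (f left)
... | yes _ | no ¬c = no λ f → ¬c (f right)

isTiling? : ∀ {l} (b : Board l) → Dec (IsTiling b)
isTiling? b = side? (λ σ → all? (λ i → consistent? b σ i))

crosses? : ∀ {l} (b : Board l) j σ i → Dec (Crosses b j σ i)
crosses? b j σ i = (toℕ i <? j) ×-dec (j <? (toℕ i ∸ tooth (slot b σ i)) + size (slot b σ i))

isMetatile? : ∀ {l} (b : Board l) → Dec (IsMetatile b)
isMetatile? b = isTiling? b ×-dec
  all? (λ j → (1 ≤? toℕ j) →-dec any? (λ i → crosses? b (toℕ j) left i ⊎-dec crosses? b (toℕ j) right i))

endsWith? : ∀ m₁ m₂ {l} (b : Board l) → Dec (EndsWith m₁ m₂ b)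
endsWith? m₁ m₂ {zero}  b = no λ ()
endsWith? m₁ m₂ {suc n} b = (size (slot b left (fromℕ n)) ≟ℕ m₁) ×-dec (size (slot b right (fromℕ n)) ≟ℕ m₂)

allVecs : (n : ℕ) → List (Vec Label n)
allVecs zero    = [] ∷ []
allVecs (suc n) = concatMap (λ x → map (x ∷_) (allVecs n)) allLabels

allBoards : (n : ℕ) → List (Board n)
allBoards n = concatMap (λ L → map (L ,_) (allVecs n)) (allVecs n)

μ : ℕ → ℕ → ℕ → ℕ
μ m₁ m₂ l = length (filter (λ b → isMetatile? b ×-dec endsWith? m₁ m₂ b) (allBoards l))

μℤ : ℕ → ℕ → ℤ → ℕ
μℤ m₁ m₂ (+ n)    = μ m₁ m₂ n
μℤ m₁ m₂ -[1+ n ] = 0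

δ : ℤ → ℤ → ℕ
δ i j with i Data.Integer.≟ j
... | yes _ = 1
... | no  _ = 0

{-# OPTIONS --safe #-}
module Submission where

-- A labelling of the two rows is a metatile ending in an (m₁, m₂) column exactly when each row
-- is a sequence of complete combs (its first cell starts a comb, every later cell carries either
-- the next tooth of the comb to its left or the first tooth of a new comb after a finished one,
-- and the last cell finishes its comb), every cell but the first carries a tooth of positive
-- index in at least one of the two rows, and the last column holds the last teeth of an m₁- and
-- an m₂-comb.  These conditions only relate neighbouring columns, so the metatiles are counted
-- by a transfer operator acting on weights of the last column.  The labels that may precede a
-- label depend only on its tooth index, so the number V p s t of good prefixes of length p + 1
-- whose last column carries teeth of indices s and t obeys a recursion on the nine pairs (s, t).
-- For the pairs (0,1), (0,2), (1,2) it reads x′ = x + y, y′ = x + z, z′ = x once the prefixes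
-- are long enough, so all three are tribonacci sequences, and μ^{[m₁m₂]}_l = V (l − 1) (m₁ − 1) (m₂ − 1).

open import Defs

module Metatiles where

  open import Data.Bool using (Bool; true; false; _∧_; T; if_then_else_)
  open import Data.Bool.Properties using (∧-assoc; ∧-comm; ∨-comm; ∧-identityʳ; ∧-zeroʳ; T-∧)
  open import Data.Empty using (⊥-elim)
  open import Data.Fin using (Fin; toℕ; fromℕ; fromℕ<) renaming (zero to fzero; suc to fsuc)
  open import Data.Fin.Properties using (toℕ<n; toℕ-fromℕ<; toℕ-fromℕ)
  open import Data.List using (List; []; _∷_; _++_; map; concatMap; filter; length)
  open import Data.Nat using (ℕ; zero; suc; _+_; _*_; _∸_; _≤_; _<_; z≤n; s≤s; s≤s⁻¹; _≟_; _<?_)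
  open import Data.Nat.Properties
  open import Data.Nat.Tactic.RingSolver using (solve-∀)
  open import Data.Product using (∃; _×_; _,_; proj₁; proj₂)
  open import Data.Sum using (_⊎_; inj₁; inj₂)
  open import Data.Unit using (tt)
  open import Data.Vec using (Vec; []; _∷_; _∷ʳ_; last; lookup)
  open import Data.Vec.Properties using (last-∷ʳ)
  open import Function using (_∘_; Equivalence)
  open import Relation.Nullary using (Dec; does; ¬_)
  open import Relation.Nullary.Decidable using (yes; no; _×-dec_; _⊎-dec_; map′; dec-true; dec-false)
  open import Relation.Unary using (Decidable)
  open import Relation.Binary.PropositionalEquality
  open ≡-Reasoning

  ∑ : {A : Set} → List A → (A → ℕ) → ℕ
  ∑ []       f = 0
  ∑ (x ∷ xs) f = f x + ∑ xs f

  infix 5 ∑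
  syntax ∑ xs (λ x → e) = ∑[ x ∈ xs ] e

  module _ {A : Set} where

    ∑-cong : ∀ (xs : List A) {f g : A → ℕ} → (∀ x → f x ≡ g x) → ∑ xs f ≡ ∑ xs g
    ∑-cong []       f≗g = refl
    ∑-cong (x ∷ xs) f≗g = cong₂ _+_ (f≗g x) (∑-cong xs f≗g)

    ∑-++ : ∀ (xs ys : List A) (f : A → ℕ) → ∑ (xs ++ ys) f ≡ ∑ xs f + ∑ ys f
    ∑-++ []       ys f = refl
    ∑-++ (x ∷ xs) ys f = trans (cong (f x +_) (∑-++ xs ys f)) (sym (+-assoc (f x) _ _))

    ∑-+ : ∀ (xs : List A) (f g : A → ℕ) → ∑[ x ∈ xs ] (f x + g x) ≡ ∑ xs f + ∑ xs g
    ∑-+ []       f g = refl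
    ∑-+ (x ∷ xs) f g = trans (cong (f x + g x +_) (∑-+ xs f g)) (+-+-shuffle (f x) (g x) _ _)
      where
      +-+-shuffle : ∀ a b c d → a + b + (c + d) ≡ a + c + (b + d)
      +-+-shuffle = solve-∀

    ∑-*ˡ : ∀ (xs : List A) c (f : A → ℕ) → c * ∑ xs f ≡ ∑[ x ∈ xs ] c * f x
    ∑-*ˡ []       c f = *-zeroʳ c
    ∑-*ˡ (x ∷ xs) c f = trans (*-distribˡ-+ c (f x) _) (cong (c * f x +_) (∑-*ˡ xs c f))

    ∑-*ʳ : ∀ (xs : List A) (f : A → ℕ) c → ∑ xs f * c ≡ ∑[ x ∈ xs ] f x * c
    ∑-*ʳ []       f c = refl
    ∑-*ʳ (x ∷ xs) f c = trans (*-distribʳ-+ c (f x) _) (cong (f x * c +_) (∑-*ʳ xs f c))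

    ∑-zero : ∀ (xs : List A) → ∑[ x ∈ xs ] 0 ≡ 0
    ∑-zero []       = refl
    ∑-zero (x ∷ xs) = ∑-zero xs

    ∑-if : ∀ (xs : List A) b (f : A → ℕ) → ∑[ x ∈ xs ] (if b then f x else 0) ≡ (if b then ∑ xs f else 0)
    ∑-if xs true  f = refl
    ∑-if xs false f = ∑-zero xs

    length-filter : ∀ {P : A → Set} (P? : Decidable P) xs →
                    length (filter P? xs) ≡ ∑[ x ∈ xs ] (if does (P? x) then 1 else 0)
    length-filter P? []       = refl
    length-filter P? (x ∷ xs) with does (P? x)
    ... | true  = cong suc (length-filter P? xs)
    ... | false = length-filter P? xs

  module _ {A B : Set} where

    ∑-map : ∀ (h : A → B) xs (f : B → ℕ) → ∑ (map h xs) f ≡ ∑ xs (f ∘ h)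
    ∑-map h []       f = refl
    ∑-map h (x ∷ xs) f = cong (f (h x) +_) (∑-map h xs f)

    ∑-concatMap : ∀ (h : A → List B) xs (f : B → ℕ) → ∑ (concatMap h xs) f ≡ ∑[ x ∈ xs ] ∑ (h x) f
    ∑-concatMap h []       f = refl
    ∑-concatMap h (x ∷ xs) f = trans (∑-++ (h x) _ f) (cong (∑ (h x) f +_) (∑-concatMap h xs f))

    ∑-swap : ∀ (xs : List A) (ys : List B) (f : A → B → ℕ) →
             ∑[ x ∈ xs ] ∑[ y ∈ ys ] f x y ≡ ∑[ y ∈ ys ] ∑[ x ∈ xs ] f x y
    ∑-swap []       ys f = sym (∑-zero ys)
    ∑-swap (x ∷ xs) ys f = trans (cong ((∑[ y ∈ ys ] f x y) +_) (∑-swap xs ys f)) (sym (∑-+ ys (f x) _))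

  ∑∑-swap : ∀ {A B C D : Set} (xs : List A) (ys : List B) (us : List C) (vs : List D) (f : A → B → C → D → ℕ) →
            ∑[ x ∈ xs ] ∑[ y ∈ ys ] ∑[ u ∈ us ] ∑[ v ∈ vs ] f x y u v ≡ ∑[ u ∈ us ] ∑[ v ∈ vs ] ∑[ x ∈ xs ] ∑[ y ∈ ys ] f x y u v
  ∑∑-swap xs ys us vs f = begin
    ∑[ x ∈ xs ] ∑[ y ∈ ys ] ∑[ u ∈ us ] ∑[ v ∈ vs ] f x y u v
      ≡⟨ ∑-cong xs (λ x → ∑-swap ys us λ y u → ∑[ v ∈ vs ] f x y u v) ⟩
    ∑[ x ∈ xs ] ∑[ u ∈ us ] ∑[ y ∈ ys ] ∑[ v ∈ vs ] f x y u v
      ≡⟨ ∑-cong xs (λ x → ∑-cong us λ u → ∑-swap ys vs (λ y v → f x y u v)) ⟩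
    ∑[ x ∈ xs ] ∑[ u ∈ us ] ∑[ v ∈ vs ] ∑[ y ∈ ys ] f x y u v
      ≡⟨ ∑-swap xs us (λ x u → ∑[ v ∈ vs ] ∑[ y ∈ ys ] f x y u v) ⟩
    ∑[ u ∈ us ] ∑[ x ∈ xs ] ∑[ v ∈ vs ] ∑[ y ∈ ys ] f x y u v
      ≡⟨ ∑-cong us (λ u → ∑-swap xs vs λ x v → ∑[ y ∈ ys ] f x y u v) ⟩
    ∑[ u ∈ us ] ∑[ v ∈ vs ] ∑[ x ∈ xs ] ∑[ y ∈ ys ] f x y u v ∎

  if-∧ : ∀ b c (n : ℕ) → (if b ∧ c then n else 0) ≡ (if b then (if c then n else 0) else 0)
  if-∧ true  c n = refl
  if-∧ false c n = refl

  if-∧-true : ∀ c n → (if c ∧ true then n else 0) ≡ n * (if c then 1 else 0)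
  if-∧-true true  n = sym (*-identityʳ n)
  if-∧-true false n = sym (*-zeroʳ n)

  if-* : ∀ c m n → (if c then m else 0) * n ≡ m * (if c then n else 0)
  if-* true  m n = refl
  if-* false m n = sym (*-zeroʳ m)

  if-0 : ∀ c → (if c then 0 else 0) ≡ 0
  if-0 true  = refl
  if-0 false = refl

  ∑-allVecs-∷ : ∀ n g → ∑ (allVecs (suc n)) g ≡ ∑[ x ∈ allLabels ] ∑[ v ∈ allVecs n ] g (x ∷ v)
  ∑-allVecs-∷ n g =
    trans (∑-concatMap (λ x → map (x ∷_) (allVecs n)) allLabels g) (∑-cong allLabels λ x → ∑-map (x ∷_) (allVecs n) g)

  ∑-allVecs-1 : ∀ g → ∑ (allVecs 1) g ≡ ∑[ x ∈ allLabels ] g (x ∷ [])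
  ∑-allVecs-1 g = trans (∑-allVecs-∷ 0 g) (∑-cong allLabels λ x → +-identityʳ (g (x ∷ [])))

  ∑-allVecs-∷ʳ : ∀ n g → ∑ (allVecs (suc n)) g ≡ ∑[ v ∈ allVecs n ] ∑[ x ∈ allLabels ] g (v ∷ʳ x)
  ∑-allVecs-∷ʳ zero    g = trans (∑-allVecs-1 g) (sym (+-identityʳ _))
  ∑-allVecs-∷ʳ (suc n) g = begin
    ∑ (allVecs (suc (suc n))) g                                                ≡⟨ ∑-allVecs-∷ (suc n) g ⟩
    ∑[ x ∈ allLabels ] ∑[ v ∈ allVecs (suc n) ] g (x ∷ v)                      ≡⟨ ∑-cong allLabels (λ x → ∑-allVecs-∷ʳ n (g ∘ (x ∷_))) ⟩
    ∑[ x ∈ allLabels ] ∑[ v ∈ allVecs n ] ∑[ y ∈ allLabels ] g (x ∷ (v ∷ʳ y)) ≡⟨ ∑-allVecs-∷ n _ ⟨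
    ∑[ v ∈ allVecs (suc n) ] ∑[ y ∈ allLabels ] g (v ∷ʳ y)                     ∎

  ∑-allBoards : ∀ n g → ∑ (allBoards n) g ≡ ∑[ L ∈ allVecs n ] ∑[ R ∈ allVecs n ] g (L , R)
  ∑-allBoards n g = trans (∑-concatMap _ (allVecs n) g) (∑-cong (allVecs n) λ L → ∑-map (L ,_) (allVecs n) g)

  Starts Ends Continues : Label → Set
  Starts x    = tooth x ≡ 0
  Ends x      = suc (tooth x) ≡ size x
  Continues x = 0 < tooth x

  data Follows (x y : Label) : Set where
    fresh : Ends x → Starts y → Follows x y
    same  : size y ≡ size x → tooth y ≡ suc (tooth x) → Follows x y

  starts? : ∀ x → Dec (Starts x)
  starts? x = tooth x ≟ 0

  ends? : ∀ x → Dec (Ends x)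
  ends? x = suc (tooth x) ≟ size x

  continues? : ∀ x → Dec (Continues x)
  continues? x = 0 <? tooth x

  follows? : ∀ x y → Dec (Follows x y)
  follows? x y = map′ from to ((ends? x ×-dec starts? y) ⊎-dec (size y ≟ size x ×-dec tooth y ≟ suc (tooth x)))
    where
    from : (Ends x × Starts y) ⊎ (size y ≡ size x × tooth y ≡ suc (tooth x)) → Follows x y
    from (inj₁ (e , s)) = fresh e s
    from (inj₂ (s , t)) = same s t
    to : Follows x y → (Ends x × Starts y) ⊎ (size y ≡ size x × tooth y ≡ suc (tooth x))
    to (fresh e s) = inj₁ (e , s)
    to (same s t)  = inj₂ (s , t)

  tooth<size : ∀ x → tooth x < size x
  tooth<size h₀ = s≤s z≤n
  tooth<size f₀ = s≤s z≤n
  tooth<size f₁ = s≤s (s≤s z≤n)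
  tooth<size c₀ = s≤s z≤n
  tooth<size c₁ = s≤s (s≤s z≤n)
  tooth<size c₂ = s≤s (s≤s (s≤s z≤n))

  -- Out of range, cells read as h₀; they are only ever read in range.
  at : ∀ {n} → Vec Label n → ℕ → Label
  at []       _       = h₀
  at (x ∷ xs) zero    = x
  at (x ∷ xs) (suc i) = at xs i

  lookup≡at : ∀ {n} (w : Vec Label n) (i : Fin n) → lookup w i ≡ at w (toℕ i)
  lookup≡at (x ∷ w) fzero    = refl
  lookup≡at (x ∷ w) (fsuc i) = lookup≡at w i

  lookup-fromℕ≡at : ∀ {n} (w : Vec Label (suc n)) → lookup w (fromℕ n) ≡ at w n
  lookup-fromℕ≡at {n} w = trans (lookup≡at w (fromℕ n)) (cong (at w) (toℕ-fromℕ n))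

  last≡at : ∀ {n} (w : Vec Label (suc n)) → last w ≡ at w n
  last≡at {zero}  (x ∷ []) = refl
  last≡at {suc n} (x ∷ w)  = last≡at w

  ends-of-fit : ∀ {n t s} → t ≤ n → t < s → (n ∸ t) + s ≤ suc n → suc t ≡ s
  ends-of-fit {n} {t} {s} t≤n t<s fit = ≤-antisym t<s (+-cancelˡ-≤ (n ∸ t) s (suc t) (≤-trans fit (≤-reflexive 1+n≡)))
    where
    1+n≡ : suc n ≡ (n ∸ t) + suc t
    1+n≡ = trans (cong suc (sym (m∸n+n≡m t≤n))) (sym (+-suc (n ∸ t) t))

  next-in-comb : ∀ {i t s} → t ≤ i → suc (suc t) ≤ s → suc i < (i ∸ t) + s
  next-in-comb {i} {t} {s} t≤i 2+t≤s = ≤-trans (≤-reflexive 2+i≡) (+-monoʳ-≤ (i ∸ t) 2+t≤s)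
    where
    2+i≡ : suc (suc i) ≡ (i ∸ t) + suc (suc t)
    2+i≡ = sym (trans (+-suc (i ∸ t) (suc t)) (cong suc (trans (+-suc (i ∸ t) t) (cong suc (m∸n+n≡m t≤i)))))

  block-fits : ∀ {st n} s → 0 < s → (∀ k → k < s → k + st ≤ n) → st + s ≤ suc n
  block-fits {st} {n} (suc s) _ bound = subst (_≤ suc n) (sym (trans (+-suc st s) (cong suc (+-comm st s)))) (s≤s (bound s ≤-refl))

  ∀-Fin⇒∀-< : ∀ {l} {P : ℕ → Set} → (∀ (j : Fin l) → P (toℕ j)) → ∀ j → j < l → P j
  ∀-Fin⇒∀-< {P = P} h j j<l = subst P (toℕ-fromℕ< j<l) (h (fromℕ< j<l))

  module Row {n : ℕ} (w : Vec Label (suc n)) where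

    cell : ℕ → Label
    cell = at w

    Agrees : ℕ → Label → ℕ → Label → Set
    Agrees i lab j lab′ = i ∸ tooth lab ≤ j → j < (i ∸ tooth lab) + size lab →
                          size lab′ ≡ size lab × tooth lab′ + i ≡ j + tooth lab

    -- Consistent (L , R) left i unfolds to Row.PlacedFin L i (lookup L i), and
    -- Crosses (L , R) j left i to Row.Spans L j (toℕ i) (lookup L i).
    PlacedFin : Fin (suc n) → Label → Set
    PlacedFin i lab = tooth lab ≤ toℕ i × (toℕ i ∸ tooth lab) + size lab ≤ suc n × (∀ j → Agrees (toℕ i) lab (toℕ j) (lookup w j))

    Placed : ℕ → Label → Set
    Placed i lab = tooth lab ≤ i × (i ∸ tooth lab) + size lab ≤ suc n × (∀ j → j < suc n → Agrees i lab j (cell j))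

    Tiled : Set
    Tiled = ∀ i → i < suc n → Placed i (cell i)

    Spans : ℕ → ℕ → Label → Set
    Spans j i lab = i < j × j < (i ∸ tooth lab) + size lab

    placedFin⇒placed : ∀ i lab → PlacedFin i lab → Placed (toℕ i) lab
    placedFin⇒placed i lab (t≤i , fits , agrees) =
      t≤i , fits , ∀-Fin⇒∀-< λ j → subst (Agrees (toℕ i) lab (toℕ j)) (lookup≡at w j) (agrees j)

    placed⇒placedFin : ∀ i lab → Placed (toℕ i) lab → PlacedFin i lab
    placed⇒placedFin i lab (t≤i , fits , agrees) =
      t≤i , fits , λ j → subst (Agrees (toℕ i) lab (toℕ j)) (sym (lookup≡at w j)) (agrees (toℕ j) (toℕ<n j))

    tiledFin⇒tiled : (∀ i → PlacedFin i (lookup w i)) → Tiled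
    tiledFin⇒tiled h = ∀-Fin⇒∀-< λ i → subst (Placed (toℕ i)) (lookup≡at w i) (placedFin⇒placed i _ (h i))

    tiled⇒tiledFin : Tiled → ∀ i → PlacedFin i (lookup w i)
    tiled⇒tiledFin h i = placed⇒placedFin i _ (subst (Placed (toℕ i)) (sym (lookup≡at w i)) (h (toℕ i) (toℕ<n i)))

    record Local : Set where
      field
        first : Starts (cell 0)
        next  : ∀ i → i < n → Follows (cell i) (cell (suc i))
        final : Ends (cell n)

    -- A comb that does not end in cell i covers cell i + 1 with a positive tooth index, and the comb
    -- of a positive tooth in cell i + 1 covers cell i.
    tiled⇒follows : Tiled → ∀ i → i < n → Follows (cell i) (cell (suc i))
    tiled⇒follows tiled i i<n with tooth (cell (suc i)) in eq | tiled i (m≤n⇒m≤1+n i<n) | tiled (suc i) (s≤s i<n)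
    ... | zero | t≤i , _ , agrees | _ = fresh (≤-antisym (tooth<size (cell i)) (≮⇒≥ ends)) eq
      where
      ends : ¬ suc (tooth (cell i)) < size (cell i)
      ends 2+t≤s = m≢1+m+n i (trans (cong (_+ i) (sym eq))
                     (proj₂ (agrees (suc i) (s≤s i<n) (≤-trans (m∸n≤m i (tooth (cell i))) (n≤1+n i)) (next-in-comb t≤i 2+t≤s))))
    ... | suc k | _ | 1+k≤1+i , _ , agrees =
      let sz , tz = agrees i (m≤n⇒m≤1+n i<n) (m∸n≤m i k) (<-trans (n<1+n i) (next-in-comb (s≤s⁻¹ 1+k≤1+i) 2+k≤s))
      in same (sym sz) (trans eq (cong suc (sym (+-cancelʳ-≡ (suc i) _ k (trans tz (trans (+-comm i (suc k)) (sym (+-suc k i))))))))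
      where
      2+k≤s : suc (suc k) ≤ size (cell (suc i))
      2+k≤s = subst (_< size (cell (suc i))) eq (tooth<size (cell (suc i)))

    tiled⇒local : Tiled → Local
    tiled⇒local tiled = record
      { first = n≤0⇒n≡0 (proj₁ (tiled 0 (s≤s z≤n)))
      ; next  = tiled⇒follows tiled
      ; final = let t≤n , fits , _ = tiled n ≤-refl in ends-of-fit t≤n (tooth<size (cell n)) fits
      }

    module _ (loc : Local) where
      open Local loc

      tooth≤index : ∀ i → i ≤ n → tooth (cell i) ≤ i
      tooth≤index zero    _   = ≤-reflexive first
      tooth≤index (suc i) i<n with next i i<n
      ... | fresh _ t≡0 = subst (_≤ suc i) (sym t≡0) z≤n
      ... | same _ t≡   = subst (_≤ suc i) (sym t≡) (s≤s (tooth≤index i (<⇒≤ i<n)))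

      walk-back : ∀ k i → i ≤ n → k ≤ tooth (cell i) →
                  size (cell (i ∸ k)) ≡ size (cell i) × tooth (cell (i ∸ k)) + k ≡ tooth (cell i)
      walk-back zero    i       _   _   = refl , +-identityʳ _
      walk-back (suc k) zero    _   k<t = ⊥-elim (n≮0 (subst (suc k ≤_) first k<t))
      walk-back (suc k) (suc i) i<n k<t with next i i<n
      ... | fresh _ t≡0 = ⊥-elim (n≮0 (subst (suc k ≤_) t≡0 k<t))
      ... | same s≡ t≡  =
        let s′ , t′ = walk-back k i (<⇒≤ i<n) (s≤s⁻¹ (subst (suc k ≤_) t≡ k<t))
        in trans s′ (sym s≡) , trans (+-suc _ k) (trans (cong suc t′) (sym t≡))

      comb-continues : ∀ i → i ≤ n → suc (tooth (cell i)) < size (cell i) →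
                       i < n × size (cell (suc i)) ≡ size (cell i) × tooth (cell (suc i)) ≡ suc (tooth (cell i))
      comb-continues i i≤n 1+t<s = i<n , same-comb (next i i<n)
        where
        not-end : ¬ Ends (cell i)
        not-end = <⇒≢ 1+t<s
        i<n : i < n
        i<n = ≤∧≢⇒< i≤n λ i≡n → not-end (subst (Ends ∘ cell) (sym i≡n) final)
        same-comb : Follows (cell i) (cell (suc i)) → size (cell (suc i)) ≡ size (cell i) × tooth (cell (suc i)) ≡ suc (tooth (cell i))
        same-comb (fresh e _)  = ⊥-elim (not-end e)
        same-comb (same s≡ t≡) = s≡ , t≡

      walk-forward : ∀ st → Starts (cell st) → st ≤ n → ∀ k → k < size (cell st) →
                     k + st ≤ n × size (cell (k + st)) ≡ size (cell st) × tooth (cell (k + st)) ≡ k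
      walk-forward st s₀ st≤n zero    _   = st≤n , refl , s₀
      walk-forward st s₀ st≤n (suc k) k<s =
        let k+st≤n , s≡ , t≡ = walk-forward st s₀ st≤n k (<-trans (n<1+n k) k<s)
            k+st<n , s≡′ , t≡′ = comb-continues (k + st) k+st≤n (subst₂ _<_ (cong suc (sym t≡)) (sym s≡) k<s)
        in k+st<n , trans s≡′ s≡ , trans t≡′ (cong suc t≡)

      -- Cell i carries tooth t of a comb occupying the cells i ∸ t, …, i ∸ t + s − 1 with teeth 0, …, s − 1.
      local⇒tiled : Tiled
      local⇒tiled i i<l = t≤i , fits , agrees
        where
        i≤n : i ≤ n
        i≤n = s≤s⁻¹ i<l
        t s st : ℕ
        t  = tooth (cell i)
        s  = size (cell i)
        st = i ∸ t
        t≤i : t ≤ i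
        t≤i = tooth≤index i i≤n
        back : size (cell st) ≡ s × tooth (cell st) + t ≡ t
        back = walk-back t i i≤n ≤-refl
        block : ∀ k → k < s → k + st ≤ n × size (cell (k + st)) ≡ s × tooth (cell (k + st)) ≡ k
        block k k<s =
          let b , s≡ , t≡ = walk-forward st (+-cancelʳ-≡ t _ 0 (proj₂ back)) (≤-trans (m∸n≤m i t) i≤n) k
                              (subst (k <_) (sym (proj₁ back)) k<s)
          in b , trans s≡ (proj₁ back) , t≡
        fits : st + s ≤ suc n
        fits = block-fits s (≤-<-trans z≤n (tooth<size (cell i))) λ k k<s → proj₁ (block k k<s)
        agrees : ∀ j → j < suc n → Agrees i (cell i) j (cell j)
        agrees j _ st≤j j<st+s = subst (λ j → size (cell j) ≡ s × tooth (cell j) + i ≡ j + t) k+st≡j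
                                   (s≡ , trans (cong (_+ i) t≡) (trans (cong (k +_) (sym (m∸n+n≡m t≤i))) (sym (+-assoc k st t))))
          where
          k : ℕ
          k = j ∸ st
          k+st≡j : k + st ≡ j
          k+st≡j = m∸n+n≡m st≤j
          k<s : k < s
          k<s = +-cancelʳ-< st k s (subst₂ _<_ (sym k+st≡j) (+-comm st s) j<st+s)
          s≡ : size (cell (k + st)) ≡ s
          s≡ = proj₁ (proj₂ (block k k<s))
          t≡ : tooth (cell (k + st)) ≡ k
          t≡ = proj₂ (proj₂ (block k k<s))

      continues⇒spans : ∀ i → i < n → Continues (cell (suc i)) → Spans (suc i) i (cell i)
      continues⇒spans i i<n c with next i i<n
      ... | fresh _ t≡0 = ⊥-elim (<⇒≢ c (sym t≡0))
      ... | same s≡ t≡  = n<1+n i , next-in-comb (tooth≤index i (<⇒≤ i<n)) (subst₂ _<_ t≡ s≡ (tooth<size (cell (suc i))))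

    spans⇒continues : Tiled → ∀ {j i} → j < suc n → i < suc n → Spans j i (cell i) → Continues (cell j)
    spans⇒continues tiled {j} {i} j<l i<l (i<j , j<end) = n≢0⇒n>0 λ t≡0 → <⇒≱ i<j (j≤i t≡0)
      where
      agree : tooth (cell j) + i ≡ j + tooth (cell i)
      agree = proj₂ (proj₂ (proj₂ (tiled i i<l)) j j<l (≤-trans (m∸n≤m i (tooth (cell i))) (<⇒≤ i<j)) j<end)
      j≤i : tooth (cell j) ≡ 0 → j ≤ i
      j≤i t≡0 = subst (j ≤_) (trans (sym agree) (cong (_+ i) t≡0)) (m≤m+n j _)

    spansFin⇒continues : Tiled → ∀ {j} (i : Fin (suc n)) → j < suc n → Spans j (toℕ i) (lookup w i) → Continues (cell j)
    spansFin⇒continues tiled i j<l sp = spans⇒continues tiled j<l (toℕ<n i) (subst (Spans _ (toℕ i)) (lookup≡at w i) sp)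

    spans⇒spansFin : ∀ {j i} (i<l : i < suc n) → Spans j i (cell i) → Spans j (toℕ (fromℕ< i<l)) (lookup w (fromℕ< i<l))
    spans⇒spansFin {j} i<l sp =
      subst (Spans j _) (sym (lookup≡at w (fromℕ< i<l))) (subst (λ k → Spans j k (cell k)) (sym (toℕ-fromℕ< i<l)) sp)

  -- Metatiles as locally good labellings

  Step : Label → Label → Label → Label → Set
  Step a b a′ b′ = (Continues a′ ⊎ Continues b′) × Follows a a′ × Follows b b′

  step? : ∀ a b a′ b′ → Dec (Step a b a′ b′)
  step? a b a′ b′ = (continues? a′ ⊎-dec continues? b′) ×-dec follows? a a′ ×-dec follows? b b′

  LastTooth : ℕ → Label → Set
  LastTooth m x = Ends x × size x ≡ m

  lastTooth? : ∀ m x → Dec (LastTooth m x)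
  lastTooth? m x = ends? x ×-dec size x ≟ m

  Good : ℕ → ℕ → ∀ {n} → Vec Label (suc n) → Vec Label (suc n) → Set
  Good m₁ m₂ {n} L R =
    (Starts (at L 0) × Starts (at R 0)) × (∀ j → j < n → Step (at L j) (at R j) (at L (suc j)) (at R (suc j)))
    × LastTooth m₁ (at L n) × LastTooth m₂ (at R n)

  module Board {n : ℕ} (L R : Vec Label (suc n)) where

    module ℒ = Row L
    module ℛ = Row R

    Joined : Set
    Joined = ∀ j → j < n → Continues (at L (suc j)) ⊎ Continues (at R (suc j))

    Cuts : Set
    Cuts = ∀ (j : Fin (suc n)) → 1 ≤ toℕ j → ∃ λ i → Crosses (L , R) (toℕ j) left i ⊎ Crosses (L , R) (toℕ j) right i

    cuts⇒joined : ℒ.Tiled → ℛ.Tiled → Cuts → Joined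
    cuts⇒joined tl tr cuts j j<n with cuts (fsuc (fromℕ< j<n)) (s≤s z≤n)
    ... | i , inj₁ c = inj₁ (subst (Continues ∘ at L ∘ suc) (toℕ-fromℕ< j<n) (ℒ.spansFin⇒continues tl i (s≤s (toℕ<n (fromℕ< j<n))) c))
    ... | i , inj₂ c = inj₂ (subst (Continues ∘ at R ∘ suc) (toℕ-fromℕ< j<n) (ℛ.spansFin⇒continues tr i (s≤s (toℕ<n (fromℕ< j<n))) c))

    toℕ<1+n : (j : Fin n) → toℕ j < suc n
    toℕ<1+n j = m≤n⇒m≤1+n (toℕ<n j)

    joined⇒cuts : ℒ.Local → ℛ.Local → Joined → Cuts
    joined⇒cuts ll lr joined (fsuc j) _ with joined (toℕ j) (toℕ<n j)
    ... | inj₁ c = fromℕ< (toℕ<1+n j) , inj₁ (ℒ.spans⇒spansFin (toℕ<1+n j) (ℒ.continues⇒spans ll (toℕ j) (toℕ<n j) c))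
    ... | inj₂ c = fromℕ< (toℕ<1+n j) , inj₂ (ℛ.spans⇒spansFin (toℕ<1+n j) (ℛ.continues⇒spans lr (toℕ j) (toℕ<n j) c))

    metatile⇒Good : ∀ {m₁ m₂} → IsMetatile (L , R) × EndsWith m₁ m₂ (L , R) → Good m₁ m₂ L R
    metatile⇒Good ((tiling , cuts) , e₁ , e₂) =
      (ℒ.Local.first ll , ℛ.Local.first lr) , (λ j j<n → joined j j<n , ℒ.Local.next ll j j<n , ℛ.Local.next lr j j<n) ,
      (ℒ.Local.final ll , trans (cong size (sym (lookup-fromℕ≡at L))) e₁) ,
      (ℛ.Local.final lr , trans (cong size (sym (lookup-fromℕ≡at R))) e₂)
      where
      tl : ℒ.Tiled
      tl = ℒ.tiledFin⇒tiled (tiling left)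
      tr : ℛ.Tiled
      tr = ℛ.tiledFin⇒tiled (tiling right)
      ll : ℒ.Local
      ll = ℒ.tiled⇒local tl
      lr : ℛ.Local
      lr = ℛ.tiled⇒local tr
      joined : Joined
      joined = cuts⇒joined tl tr cuts

    Good⇒metatile : ∀ {m₁ m₂} → Good m₁ m₂ L R → IsMetatile (L , R) × EndsWith m₁ m₂ (L , R)
    Good⇒metatile ((s₁ , s₂) , steps , (e₁ , z₁) , (e₂ , z₂)) =
      (tiling , joined⇒cuts ll lr (λ j j<n → proj₁ (steps j j<n))) ,
      trans (cong size (lookup-fromℕ≡at L)) z₁ , trans (cong size (lookup-fromℕ≡at R)) z₂
      where
      ll : ℒ.Local
      ll = record { first = s₁ ; next = λ j j<n → proj₁ (proj₂ (steps j j<n)) ; final = e₁ }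
      lr : ℛ.Local
      lr = record { first = s₂ ; next = λ j j<n → proj₂ (proj₂ (steps j j<n)) ; final = e₂ }
      tiling : IsTiling (L , R)
      tiling left  = ℒ.tiled⇒tiledFin (ℒ.local⇒tiled ll)
      tiling right = ℛ.tiled⇒tiledFin (ℛ.local⇒tiled lr)

  chainᵇ : ∀ {n} → Label → Label → Vec Label n → Vec Label n → Bool
  chainᵇ a b []        []        = true
  chainᵇ a b (a′ ∷ L) (b′ ∷ R) = does (step? a b a′ b′) ∧ chainᵇ a′ b′ L R

  goodPrefixᵇ : ∀ {n} → Vec Label (suc n) → Vec Label (suc n) → Bool
  goodPrefixᵇ (a ∷ L) (b ∷ R) = does (starts? a ×-dec starts? b) ∧ chainᵇ a b L R

  goodᵇ : ℕ → ℕ → ∀ {n} → Vec Label (suc n) → Vec Label (suc n) → Bool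
  goodᵇ m₁ m₂ L R = goodPrefixᵇ L R ∧ does (lastTooth? m₁ (last L) ×-dec lastTooth? m₂ (last R))

  chainᵇ-∷ʳ : ∀ {n} a b (L R : Vec Label n) a′ b′ →
    chainᵇ a b (L ∷ʳ a′) (R ∷ʳ b′) ≡ chainᵇ a b L R ∧ does (step? (last (a ∷ L)) (last (b ∷ R)) a′ b′)
  chainᵇ-∷ʳ a b []      []      a′ b′ = ∧-identityʳ _
  chainᵇ-∷ʳ a b (x ∷ L) (y ∷ R) a′ b′ =
    trans (cong (does (step? a b x y) ∧_) (chainᵇ-∷ʳ x y L R a′ b′)) (sym (∧-assoc (does (step? a b x y)) _ _))

  goodPrefixᵇ-∷ʳ : ∀ {n} (L R : Vec Label (suc n)) a′ b′ →
    goodPrefixᵇ (L ∷ʳ a′) (R ∷ʳ b′) ≡ goodPrefixᵇ L R ∧ does (step? (last L) (last R) a′ b′)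
  goodPrefixᵇ-∷ʳ (a ∷ L) (b ∷ R) a′ b′ =
    trans (cong (does (starts? a ×-dec starts? b) ∧_) (chainᵇ-∷ʳ a b L R a′ b′)) (sym (∧-assoc (does (starts? a ×-dec starts? b)) _ _))


  T-does⇒ : ∀ {P : Set} (d : Dec P) → T (does d) → P
  T-does⇒ (yes p) _ = p

  ⇒T-does : ∀ {P : Set} (d : Dec P) → P → T (does d)
  ⇒T-does (yes _) _ = tt
  ⇒T-does (no ¬p) p = ¬p p

  does≡ : ∀ {P : Set} (d : Dec P) b → (P → T b) → (T b → P) → does d ≡ b
  does≡ d true  _ T⇒P = dec-true d (T⇒P tt)
  does≡ d false P⇒T _ = dec-false d P⇒T

  chainᵇ⇒steps : ∀ {n} a b (L R : Vec Label n) → T (chainᵇ a b L R) →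
                ∀ j → j < n → Step (at (a ∷ L) j) (at (b ∷ R) j) (at (a ∷ L) (suc j)) (at (b ∷ R) (suc j))
  chainᵇ⇒steps a b (a′ ∷ L) (b′ ∷ R) t zero    _         = T-does⇒ (step? a b a′ b′) (proj₁ (Equivalence.to T-∧ t))
  chainᵇ⇒steps a b (a′ ∷ L) (b′ ∷ R) t (suc j) (s≤s j<n) = chainᵇ⇒steps a′ b′ L R (proj₂ (Equivalence.to T-∧ t)) j j<n

  steps⇒chainᵇ : ∀ {n} a b (L R : Vec Label n) →
                (∀ j → j < n → Step (at (a ∷ L) j) (at (b ∷ R) j) (at (a ∷ L) (suc j)) (at (b ∷ R) (suc j))) → T (chainᵇ a b L R)
  steps⇒chainᵇ a b []       []       _     = tt
  steps⇒chainᵇ a b (a′ ∷ L) (b′ ∷ R) steps =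
    Equivalence.from T-∧ (⇒T-does (step? a b a′ b′) (steps 0 (s≤s z≤n)) , steps⇒chainᵇ a′ b′ L R λ j j<n → steps (suc j) (s≤s j<n))

  T-goodᵇ⇒Good : ∀ m₁ m₂ {n} (L R : Vec Label (suc n)) → T (goodᵇ m₁ m₂ L R) → Good m₁ m₂ L R
  T-goodᵇ⇒Good m₁ m₂ (a ∷ L) (b ∷ R) t =
    T-does⇒ (starts? a ×-dec starts? b) (proj₁ starts,chain) , chainᵇ⇒steps a b L R (proj₂ starts,chain) ,
    subst (LastTooth m₁) (last≡at (a ∷ L)) (proj₁ lasts) , subst (LastTooth m₂) (last≡at (b ∷ R)) (proj₂ lasts)
    where
    open Equivalence
    lasts? : Dec (LastTooth m₁ (last (a ∷ L)) × LastTooth m₂ (last (b ∷ R)))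
    lasts? = lastTooth? m₁ (last (a ∷ L)) ×-dec lastTooth? m₂ (last (b ∷ R))
    prefix,lasts : T (goodPrefixᵇ (a ∷ L) (b ∷ R)) × T (does lasts?)
    prefix,lasts = to T-∧ t
    starts,chain : T (does (starts? a ×-dec starts? b)) × T (chainᵇ a b L R)
    starts,chain = to T-∧ (proj₁ prefix,lasts)
    lasts : LastTooth m₁ (last (a ∷ L)) × LastTooth m₂ (last (b ∷ R))
    lasts = T-does⇒ lasts? (proj₂ prefix,lasts)

  Good⇒T-goodᵇ : ∀ m₁ m₂ {n} (L R : Vec Label (suc n)) → Good m₁ m₂ L R → T (goodᵇ m₁ m₂ L R)
  Good⇒T-goodᵇ m₁ m₂ (a ∷ L) (b ∷ R) (starts , steps , e₁ , e₂) =
    from T-∧ (from T-∧ (⇒T-does (starts? a ×-dec starts? b) starts , steps⇒chainᵇ a b L R steps) ,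
              ⇒T-does (lastTooth? m₁ (last (a ∷ L)) ×-dec lastTooth? m₂ (last (b ∷ R)))
                (subst (LastTooth m₁) (sym (last≡at (a ∷ L))) e₁ , subst (LastTooth m₂) (sym (last≡at (b ∷ R))) e₂))
    where open Equivalence

  metatile?≡goodᵇ : ∀ m₁ m₂ {n} (L R : Vec Label (suc n)) → does (isMetatile? (L , R) ×-dec endsWith? m₁ m₂ (L , R)) ≡ goodᵇ m₁ m₂ L R
  metatile?≡goodᵇ m₁ m₂ L R = does≡ (isMetatile? (L , R) ×-dec endsWith? m₁ m₂ (L , R)) (goodᵇ m₁ m₂ L R)
    (Good⇒T-goodᵇ m₁ m₂ L R ∘ Board.metatile⇒Good L R) (Board.Good⇒metatile L R ∘ T-goodᵇ⇒Good m₁ m₂ L R)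

  -- Counting by the last column

  prefixWeight : ℕ → (Label → Label → ℕ) → ℕ
  prefixWeight q g = ∑[ L ∈ allVecs (suc q) ] ∑[ R ∈ allVecs (suc q) ] (if goodPrefixᵇ L R then g (last L) (last R) else 0)

  extend : (Label → Label → ℕ) → Label → Label → ℕ
  extend g a b = ∑[ a′ ∈ allLabels ] ∑[ b′ ∈ allLabels ] (if does (step? a b a′ b′) then g a′ b′ else 0)

  prefixWeight-suc : ∀ q g → prefixWeight (suc q) g ≡ prefixWeight q (extend g)
  prefixWeight-suc q g = begin
    prefixWeight (suc q) g
      ≡⟨ ∑-allVecs-∷ʳ (suc q) (λ L → ∑[ R ∈ allVecs (suc (suc q)) ] G L R) ⟩
    ∑[ L ∈ Vs ] ∑[ a′ ∈ allLabels ] ∑[ R ∈ allVecs (suc (suc q)) ] G (L ∷ʳ a′) R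
      ≡⟨ ∑-cong Vs (λ L → ∑-cong allLabels λ a′ → ∑-allVecs-∷ʳ (suc q) (G (L ∷ʳ a′))) ⟩
    ∑[ L ∈ Vs ] ∑[ a′ ∈ allLabels ] ∑[ R ∈ Vs ] ∑[ b′ ∈ allLabels ] G (L ∷ʳ a′) (R ∷ʳ b′)
      ≡⟨ ∑-cong Vs (λ L → ∑-swap allLabels Vs λ a′ R → ∑[ b′ ∈ allLabels ] G (L ∷ʳ a′) (R ∷ʳ b′)) ⟩
    ∑[ L ∈ Vs ] ∑[ R ∈ Vs ] ∑[ a′ ∈ allLabels ] ∑[ b′ ∈ allLabels ] G (L ∷ʳ a′) (R ∷ʳ b′)
      ≡⟨ ∑-cong Vs (λ L → ∑-cong Vs λ R → ∑-cong allLabels λ a′ → ∑-cong allLabels λ b′ → G-∷ʳ L R a′ b′) ⟩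
    ∑[ L ∈ Vs ] ∑[ R ∈ Vs ] ∑[ a′ ∈ allLabels ] ∑[ b′ ∈ allLabels ] (if goodPrefixᵇ L R then S L R a′ b′ else 0)
      ≡⟨ ∑-cong Vs (λ L → ∑-cong Vs λ R → trans (∑-cong allLabels λ a′ → ∑-if allLabels (goodPrefixᵇ L R) (S L R a′))
                                                   (∑-if allLabels (goodPrefixᵇ L R) λ a′ → ∑[ b′ ∈ allLabels ] S L R a′ b′)) ⟩
    prefixWeight q (extend g) ∎
    where
    Vs : List (Vec Label (suc q))
    Vs = allVecs (suc q)
    G : Vec Label (suc (suc q)) → Vec Label (suc (suc q)) → ℕ
    G L R = if goodPrefixᵇ L R then g (last L) (last R) else 0
    S : Vec Label (suc q) → Vec Label (suc q) → Label → Label → ℕ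
    S L R a′ b′ = if does (step? (last L) (last R) a′ b′) then g a′ b′ else 0
    G-∷ʳ : ∀ L R a′ b′ → G (L ∷ʳ a′) (R ∷ʳ b′) ≡ (if goodPrefixᵇ L R then S L R a′ b′ else 0)
    G-∷ʳ L R a′ b′ rewrite goodPrefixᵇ-∷ʳ L R a′ b′ | last-∷ʳ a′ L | last-∷ʳ b′ R = if-∧ (goodPrefixᵇ L R) _ _

  -- V p s t counts the good prefixes of length p + 1 whose last column carries teeth s and t
  -- (prefixWeight-V); before t lists the tooth indices that may sit just left of a tooth t.
  before : ℕ → List ℕ
  before zero    = 0 ∷ 1 ∷ 2 ∷ []
  before (suc t) = t ∷ []

  V : ℕ → ℕ → ℕ → ℕ
  V zero    s t = if does (s ≟ 0 ×-dec t ≟ 0) then 1 else 0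
  V (suc p) s t = if does (0 <? s ⊎-dec 0 <? t) then ∑[ s′ ∈ before s ] ∑[ t′ ∈ before t ] V p s′ t′ else 0

  ∑-follows : ∀ a′ (h : ℕ → ℕ) → ∑[ a ∈ allLabels ] (if does (follows? a a′) then h (tooth a) else 0) ≡ ∑[ s ∈ before (tooth a′) ] h s
  ∑-follows h₀ h = refl
  ∑-follows f₀ h = refl
  ∑-follows f₁ h = refl
  ∑-follows c₀ h = refl
  ∑-follows c₁ h = refl
  ∑-follows c₂ h = refl

  ∑-step : ∀ a′ b′ (F : ℕ → ℕ → ℕ) →
    ∑[ a ∈ allLabels ] ∑[ b ∈ allLabels ] (if does (step? a b a′ b′) then F (tooth a) (tooth b) else 0)
      ≡ (if does (continues? a′ ⊎-dec continues? b′) then ∑[ s ∈ before (tooth a′) ] ∑[ t ∈ before (tooth b′) ] F s t else 0)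
  ∑-step a′ b′ F = begin
    ∑[ a ∈ allLabels ] ∑[ b ∈ allLabels ] (if c ∧ (fa a ∧ fb b) then F (tooth a) (tooth b) else 0)
      ≡⟨ ∑-cong allLabels (λ a → trans (∑-cong allLabels λ b → if-∧ c (fa a ∧ fb b) (F (tooth a) (tooth b))) (∑-if allLabels c (G a))) ⟩
    ∑[ a ∈ allLabels ] (if c then ∑ allLabels (G a) else 0)
      ≡⟨ ∑-if allLabels c (λ a → ∑ allLabels (G a)) ⟩
    (if c then ∑[ a ∈ allLabels ] ∑ allLabels (G a) else 0)
      ≡⟨ cong (λ n → if c then n else 0) (∑-cong allLabels λ a → trans (∑-cong allLabels λ b → if-∧ (fa a) (fb b) (F (tooth a) (tooth b))) (∑-if allLabels (fa a) (H a))) ⟩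
    (if c then ∑[ a ∈ allLabels ] (if fa a then ∑ allLabels (H a) else 0) else 0)
      ≡⟨ cong (λ n → if c then n else 0) (∑-cong allLabels λ a → cong (λ n → if fa a then n else 0) (∑-follows b′ (F (tooth a)))) ⟩
    (if c then ∑[ a ∈ allLabels ] (if fa a then ∑[ t ∈ before (tooth b′) ] F (tooth a) t else 0) else 0)
      ≡⟨ cong (λ n → if c then n else 0) (∑-follows a′ λ s → ∑[ t ∈ before (tooth b′) ] F s t) ⟩
    (if c then ∑[ s ∈ before (tooth a′) ] ∑[ t ∈ before (tooth b′) ] F s t else 0) ∎
    where
    c : Bool
    c = does (continues? a′ ⊎-dec continues? b′)
    fa fb : Label → Bool
    fa a = does (follows? a a′)
    fb b = does (follows? b b′)
    G H : Label → Label → ℕ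
    G a b = if fa a ∧ fb b then F (tooth a) (tooth b) else 0
    H a b = if fb b then F (tooth a) (tooth b) else 0

  prefixWeight-V : ∀ q g → prefixWeight q g ≡ ∑[ a ∈ allLabels ] ∑[ b ∈ allLabels ] g a b * V q (tooth a) (tooth b)
  prefixWeight-V zero g =
    trans (∑-allVecs-1 λ L → ∑[ R ∈ allVecs 1 ] G L R)
      (∑-cong allLabels λ a → trans (∑-allVecs-1 (G (a ∷ [])))
        (∑-cong allLabels λ b → if-∧-true (does (starts? a ×-dec starts? b)) (g a b)))
    where
    G : Vec Label 1 → Vec Label 1 → ℕ
    G L R = if goodPrefixᵇ L R then g (last L) (last R) else 0
  prefixWeight-V (suc q) g = begin
    prefixWeight (suc q) g
      ≡⟨ prefixWeight-suc q g ⟩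
    prefixWeight q (extend g)
      ≡⟨ prefixWeight-V q (extend g) ⟩
    ∑[ a ∈ allLabels ] ∑[ b ∈ allLabels ] extend g a b * V q (tooth a) (tooth b)
      ≡⟨ ∑-cong allLabels (λ a → ∑-cong allLabels λ b → distribute a b) ⟩
    ∑[ a ∈ allLabels ] ∑[ b ∈ allLabels ] ∑[ a′ ∈ allLabels ] ∑[ b′ ∈ allLabels ] g a′ b′ * W a b a′ b′
      ≡⟨ ∑∑-swap allLabels allLabels allLabels allLabels (λ a b a′ b′ → g a′ b′ * W a b a′ b′) ⟩
    ∑[ a′ ∈ allLabels ] ∑[ b′ ∈ allLabels ] ∑[ a ∈ allLabels ] ∑[ b ∈ allLabels ] g a′ b′ * W a b a′ b′
      ≡⟨ ∑-cong allLabels (λ a′ → ∑-cong allLabels λ b′ → factor a′ b′) ⟩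
    ∑[ a′ ∈ allLabels ] ∑[ b′ ∈ allLabels ] g a′ b′ * V (suc q) (tooth a′) (tooth b′) ∎
    where
    W : Label → Label → Label → Label → ℕ
    W a b a′ b′ = if does (step? a b a′ b′) then V q (tooth a) (tooth b) else 0
    distribute : ∀ a b → extend g a b * V q (tooth a) (tooth b) ≡ ∑[ a′ ∈ allLabels ] ∑[ b′ ∈ allLabels ] g a′ b′ * W a b a′ b′
    distribute a b = trans (∑-*ʳ allLabels (λ a′ → ∑[ b′ ∈ allLabels ] S a′ b′) v)
                       (∑-cong allLabels λ a′ → trans (∑-*ʳ allLabels (S a′) v)
                         (∑-cong allLabels λ b′ → if-* (does (step? a b a′ b′)) (g a′ b′) v))
      where
      v : ℕ
      v = V q (tooth a) (tooth b)
      S : Label → Label → ℕ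
      S a′ b′ = if does (step? a b a′ b′) then g a′ b′ else 0
    factor : ∀ a′ b′ → ∑[ a ∈ allLabels ] ∑[ b ∈ allLabels ] g a′ b′ * W a b a′ b′ ≡ g a′ b′ * V (suc q) (tooth a′) (tooth b′)
    factor a′ b′ = begin
      ∑[ a ∈ allLabels ] ∑[ b ∈ allLabels ] g a′ b′ * W a b a′ b′
        ≡⟨ ∑-cong allLabels (λ a → ∑-*ˡ allLabels (g a′ b′) λ b → W a b a′ b′) ⟨
      ∑[ a ∈ allLabels ] g a′ b′ * (∑[ b ∈ allLabels ] W a b a′ b′)
        ≡⟨ ∑-*ˡ allLabels (g a′ b′) (λ a → ∑[ b ∈ allLabels ] W a b a′ b′) ⟨
      g a′ b′ * (∑[ a ∈ allLabels ] ∑[ b ∈ allLabels ] W a b a′ b′)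
        ≡⟨ cong (g a′ b′ *_) (∑-step a′ b′ (V q)) ⟩
      g a′ b′ * V (suc q) (tooth a′) (tooth b′) ∎

  final : ℕ → ℕ → Label → Label → ℕ
  final m₁ m₂ a b = if does (lastTooth? m₁ a ×-dec lastTooth? m₂ b) then 1 else 0

  μ≡prefixWeight : ∀ m₁ m₂ q → μ m₁ m₂ (suc q) ≡ prefixWeight q (final m₁ m₂)
  μ≡prefixWeight m₁ m₂ q = begin
    μ m₁ m₂ (suc q)
      ≡⟨ length-filter P? (allBoards (suc q)) ⟩
    ∑[ b ∈ allBoards (suc q) ] (if does (P? b) then 1 else 0)
      ≡⟨ ∑-allBoards (suc q) (λ b → if does (P? b) then 1 else 0) ⟩
    ∑[ L ∈ allVecs (suc q) ] ∑[ R ∈ allVecs (suc q) ] (if does (P? (L , R)) then 1 else 0)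
      ≡⟨ ∑-cong (allVecs (suc q)) (λ L → ∑-cong (allVecs (suc q)) λ R →
           trans (cong (λ c → if c then 1 else 0) (metatile?≡goodᵇ m₁ m₂ L R)) (if-∧ (goodPrefixᵇ L R) _ 1)) ⟩
    prefixWeight q (final m₁ m₂) ∎
    where
    P? : ∀ b → Dec (IsMetatile b × EndsWith m₁ m₂ b)
    P? b = isMetatile? b ×-dec endsWith? m₁ m₂ b

  μ-V : ∀ m₁ m₂ q → μ m₁ m₂ (suc q) ≡ ∑[ a ∈ allLabels ] ∑[ b ∈ allLabels ] final m₁ m₂ a b * V q (tooth a) (tooth b)
  μ-V m₁ m₂ q = trans (μ≡prefixWeight m₁ m₂ q) (prefixWeight-V q (final m₁ m₂))

  -- all but one of the 36 terms of μ-V vanish, up to these + 0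
  private
    +0³ : ∀ n → n + 0 + 0 + 0 ≡ n
    +0³ = solve-∀

  μ₁₂≡V : ∀ q → μ 1 2 (suc q) ≡ V q 0 1
  μ₁₂≡V q = trans (μ-V 1 2 q) (+0³ (V q 0 1))

  μ₁₃≡V : ∀ q → μ 1 3 (suc q) ≡ V q 0 2
  μ₁₃≡V q = trans (μ-V 1 3 q) (+0³ (V q 0 2))

  μ₂₃≡V : ∀ q → μ 2 3 (suc q) ≡ V q 1 2
  μ₂₃≡V q = trans (μ-V 2 3 q) (+0³ (V q 1 2))

  -- The tribonacci recurrences

  V-sym : ∀ p s t → V p s t ≡ V p t s
  V-sym zero    s t = cong (λ c → if c then 1 else 0) (∧-comm (does (s ≟ 0)) (does (t ≟ 0)))
  V-sym (suc p) s t = cong₂ (λ c n → if c then n else 0) (∨-comm (does (0 <? s)) (does (0 <? t))) (begin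
    ∑[ s′ ∈ before s ] ∑[ t′ ∈ before t ] V p s′ t′ ≡⟨ ∑-swap (before s) (before t) (V p) ⟩
    ∑[ t′ ∈ before t ] ∑[ s′ ∈ before s ] V p s′ t′ ≡⟨ ∑-cong (before t) (λ t′ → ∑-cong (before s) λ s′ → V-sym p s′ t′) ⟩
    ∑[ t′ ∈ before t ] ∑[ s′ ∈ before s ] V p t′ s′ ∎)

  V-before-tooth : ∀ p s t → p < t → V p s t ≡ 0
  V-before-tooth zero    s (suc t) _           = cong (λ c → if c then 1 else 0) (∧-zeroʳ (does (s ≟ 0)))
  V-before-tooth (suc p) s (suc t) (s≤s p<t) =
    trans (cong (λ n → if does (0 <? s ⊎-dec 0 <? suc t) then n else 0)
            (trans (∑-cong (before s) λ s′ → cong (_+ 0) (V-before-tooth p s′ t p<t)) (∑-zero (before s))))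
          (if-0 _)

  -- the unfolding of ∑[ s′ ∈ before 0 ] ∑[ t′ ∈ before (suc t) ] _
  private
    sum₃ : ∀ a b c → a + 0 + (b + 0 + (c + 0 + 0)) ≡ a + b + c
    sum₃ = solve-∀

  V-suc-01 : ∀ p → V (suc p) 0 1 ≡ V p 0 0 + V p 0 1 + V p 0 2
  V-suc-01 p = trans (sum₃ (V p 0 0) (V p 1 0) (V p 2 0)) (cong₂ (λ m n → V p 0 0 + m + n) (V-sym p 1 0) (V-sym p 2 0))

  V-suc-02 : ∀ p → V (suc p) 0 2 ≡ V p 0 1 + V p 1 1 + V p 1 2
  V-suc-02 p = trans (sum₃ (V p 0 1) (V p 1 1) (V p 2 1)) (cong (V p 0 1 + V p 1 1 +_) (V-sym p 2 1))

  V-suc-12 : ∀ p → V (suc p) 1 2 ≡ V p 0 1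
  V-suc-12 p = trans (+-identityʳ _) (+-identityʳ _)

  V-suc-11 : ∀ p → V (suc p) 1 1 ≡ V p 0 0
  V-suc-11 p = trans (+-identityʳ _) (+-identityʳ _)

  V-02-via-01 : ∀ p → V (3 + p) 0 2 ≡ V (2 + p) 0 1 + V (1 + p) 0 1
  V-02-via-01 p = begin
    V (3 + p) 0 2                                  ≡⟨ V-suc-02 (2 + p) ⟩
    V (2 + p) 0 1 + V (2 + p) 1 1 + V (2 + p) 1 2  ≡⟨ cong₂ (λ m n → V (2 + p) 0 1 + m + n) (V-suc-11 (1 + p)) (V-suc-12 (1 + p)) ⟩
    V (2 + p) 0 1 + 0 + V (1 + p) 0 1              ≡⟨ cong (_+ V (1 + p) 0 1) (+-identityʳ (V (2 + p) 0 1)) ⟩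
    V (2 + p) 0 1 + V (1 + p) 0 1                  ∎

  Tribonacci : (ℕ → ℕ) → Set
  Tribonacci f = ∀ n → f (3 + n) ≡ f (2 + n) + f (1 + n) + f n

  tribonacci-resp : ∀ {f g} → (∀ n → f n ≡ g n) → Tribonacci g → Tribonacci f
  tribonacci-resp {f} {g} f≗g trib n = begin
    f (3 + n)                         ≡⟨ f≗g (3 + n) ⟩
    g (3 + n)                         ≡⟨ trib n ⟩
    g (2 + n) + g (1 + n) + g n       ≡⟨ cong₂ _+_ (cong₂ _+_ (f≗g (2 + n)) (f≗g (1 + n))) (f≗g n) ⟨
    f (2 + n) + f (1 + n) + f n       ∎

  tribonacci-suc : ∀ {f} → Tribonacci f → Tribonacci (f ∘ suc)
  tribonacci-suc trib n = trib (suc n)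

  tribonacci-+ : ∀ {f g} → Tribonacci f → Tribonacci g → Tribonacci (λ n → f n + g n)
  tribonacci-+ {f} {g} tf tg n = trans (cong₂ _+_ (tf n) (tg n)) (shuffle (f (2 + n)) (f (1 + n)) (f n) (g (2 + n)) (g (1 + n)) (g n))
    where
    shuffle : ∀ a b c d e h → a + b + c + (d + e + h) ≡ a + d + (b + e) + (c + h)
    shuffle = solve-∀

  V-01-tribonacci : Tribonacci (λ p → V (1 + p) 0 1)
  V-01-tribonacci p = begin
    V (4 + p) 0 1                       ≡⟨ V-suc-01 (3 + p) ⟩
    0 + V (3 + p) 0 1 + V (3 + p) 0 2   ≡⟨ cong (V (3 + p) 0 1 +_) (V-02-via-01 p) ⟩
    V (3 + p) 0 1 + (V (2 + p) 0 1 + V (1 + p) 0 1) ≡⟨ +-assoc (V (3 + p) 0 1) _ _ ⟨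
    V (3 + p) 0 1 + V (2 + p) 0 1 + V (1 + p) 0 1 ∎

  V-02-tribonacci : Tribonacci (λ p → V (3 + p) 0 2)
  V-02-tribonacci = tribonacci-resp V-02-via-01 (tribonacci-+ {λ p → V (2 + p) 0 1} {λ p → V (1 + p) 0 1} (tribonacci-suc {λ p → V (1 + p) 0 1} V-01-tribonacci) V-01-tribonacci)

  V-12-tribonacci : Tribonacci (λ p → V (2 + p) 1 2)
  V-12-tribonacci = tribonacci-resp {g = λ p → V (1 + p) 0 1} (λ p → V-suc-12 (1 + p)) V-01-tribonacci

open Metatiles using (V; V-before-tooth; μ₁₂≡V; μ₁₃≡V; μ₂₃≡V; V-01-tribonacci; V-02-tribonacci; V-12-tribonacci)
open import Data.Nat using (ℕ; zero; suc; _+_; _*_; s≤s)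
open import Data.Nat.Properties using (+-identityʳ)
open import Data.Integer using (ℤ; +_; -[1+_]; _-_; _<_; +<+)
open import Data.Product using (_×_; _,_)
open import Relation.Binary.PropositionalEquality using (_≡_; refl; sym; trans; cong; cong₂)

νℤ : ℕ → ℕ → ℤ → ℕ
νℤ s t (+ zero)  = 0
νℤ s t (+ suc p) = V p s t
νℤ s t -[1+ _ ]  = 0

μℤ≡νℤ : ∀ {m₁ m₂ s t} → (∀ q → μ m₁ m₂ (suc q) ≡ V q s t) → ∀ l → μℤ m₁ m₂ l ≡ νℤ s t l
μℤ≡νℤ μ≡V (+ zero)  = refl
μℤ≡νℤ μ≡V (+ suc q) = μ≡V q
μℤ≡νℤ μ≡V -[1+ _ ]  = refl

μℤ-below : ∀ {m₁ m₂ s t} → (∀ q → μ m₁ m₂ (suc q) ≡ V q s t) → ∀ l → l < + suc t → μℤ m₁ m₂ l ≡ 0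
μℤ-below μ≡V (+ zero)  _                = refl
μℤ-below μ≡V (+ suc p) (+<+ (s≤s p<t)) = trans (μ≡V p) (V-before-tooth p _ _ p<t)
μℤ-below μ≡V -[1+ _ ]  _                = refl

Recurrence : (ℤ → ℕ) → (ℤ → ℕ → ℕ) → Set
Recurrence F c = ∀ l → F l ≡ c l (F (l - + 1) + F (l - + 2) + F (l - + 3))

recurrence-resp : ∀ {F G} c → (∀ l → F l ≡ G l) → Recurrence G c → Recurrence F c
recurrence-resp {F} {G} c F≗G rec l =
  trans (F≗G l) (trans (rec l) (cong (c l) (sym (cong₂ _+_ (cong₂ _+_ (F≗G (l - + 1)) (F≗G (l - + 2))) (F≗G (l - + 3))))))

+0+0 : ∀ n → n + 0 + 0 ≡ n
+0+0 n = trans (+-identityʳ (n + 0)) (+-identityʳ n)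

νℤ-01-recurrence : Recurrence (νℤ 0 1) (λ l s → s + δ l (+ 2) + δ l (+ 4))
νℤ-01-recurrence -[1+ _ ] = refl
νℤ-01-recurrence (+ 0) = refl
νℤ-01-recurrence (+ 1) = refl
νℤ-01-recurrence (+ 2) = refl
νℤ-01-recurrence (+ 3) = refl
νℤ-01-recurrence (+ 4) = refl
νℤ-01-recurrence (+ suc (suc (suc (suc (suc n))))) = trans (V-01-tribonacci n) (sym (+0+0 _))

νℤ-02-recurrence : Recurrence (νℤ 0 2) (λ l s → s + 2 * δ l (+ 3))
νℤ-02-recurrence -[1+ _ ] = refl
νℤ-02-recurrence (+ 0) = refl
νℤ-02-recurrence (+ 1) = refl
νℤ-02-recurrence (+ 2) = refl
νℤ-02-recurrence (+ 3) = refl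
νℤ-02-recurrence (+ 4) = refl
νℤ-02-recurrence (+ 5) = refl
νℤ-02-recurrence (+ 6) = refl
νℤ-02-recurrence (+ suc (suc (suc (suc (suc (suc (suc n))))))) = trans (V-02-tribonacci n) (sym (+-identityʳ _))

νℤ-12-recurrence : Recurrence (νℤ 1 2) (λ l s → s + δ l (+ 3) + δ l (+ 5))
νℤ-12-recurrence -[1+ _ ] = refl
νℤ-12-recurrence (+ 0) = refl
νℤ-12-recurrence (+ 1) = refl
νℤ-12-recurrence (+ 2) = refl
νℤ-12-recurrence (+ 3) = refl
νℤ-12-recurrence (+ 4) = refl
νℤ-12-recurrence (+ 5) = refl
νℤ-12-recurrence (+ suc (suc (suc (suc (suc (suc n)))))) = trans (V-12-tribonacci n) (sym (+0+0 _))

lemma2 :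
      (∀ (l : ℤ) → μℤ 1 2 l ≡ μℤ 1 2 (l - + 1) + μℤ 1 2 (l - + 2) + μℤ 1 2 (l - + 3) + δ l (+ 2) + δ l (+ 4))
    × (∀ (l : ℤ) → l < + 2 → μℤ 1 2 l ≡ 0)
    × (∀ (l : ℤ) → μℤ 1 3 l ≡ μℤ 1 3 (l - + 1) + μℤ 1 3 (l - + 2) + μℤ 1 3 (l - + 3) + 2 * δ l (+ 3))
    × (∀ (l : ℤ) → l < + 3 → μℤ 1 3 l ≡ 0)
    × (∀ (l : ℤ) → μℤ 2 3 l ≡ μℤ 2 3 (l - + 1) + μℤ 2 3 (l - + 2) + μℤ 2 3 (l - + 3) + δ l (+ 3) + δ l (+ 5))
    × (∀ (l : ℤ) → l < + 3 → μℤ 2 3 l ≡ 0)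
lemma2 =
  recurrence-resp (λ l s → s + δ l (+ 2) + δ l (+ 4)) (μℤ≡νℤ μ₁₂≡V) νℤ-01-recurrence ,
  μℤ-below μ₁₂≡V ,
  recurrence-resp (λ l s → s + 2 * δ l (+ 3)) (μℤ≡νℤ μ₁₃≡V) νℤ-02-recurrence ,
  μℤ-below μ₁₃≡V ,
  recurrence-resp (λ l s → s + δ l (+ 3) + δ l (+ 5)) (μℤ≡νℤ μ₂₃≡V) νℤ-12-recurrence ,
  μℤ-below μ₂₃≡V
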